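{- Let $\rho$ be a Grassmannian permutation. (1) $\rho$ is too wide if and only if $\rho$ contains at least one bivincular pattern from the family $\mathcal{F}=\{F_m: m\ge 2\}$, where for $m\ge2$ and $k=2m+1$, $F_m=(f_m,\emptyset,\{2,3,\dots,k-1\})$ with $f_m = 1,\,(m+2),(m+3),\dots,(2m),\,2,3,\dots,(m+1),\,(2m+1)\in S_k$ (so $F_2=(14235,\emptyset,\{2,3,4\})$, $F_3=(1562347,\emptyset,\{2,\dots,6\})$, $F_4=(167823459,\emptyset,\{2,\dots,8\})$, ...). (2) $\rho$ is too deep if and only if $\rho$ contains at least one bivincular pattern from the family $\mathcal{G}=\{G_m:m\ge2\}$, where for $m\ge2$ and $k=2m+1$, $G_m=(g_m,\emptyset,\{1,2,\dots,k-2\})$ with $g_m=1,\,(m+1),(m+2),\dots,(2m),\,2,3,\dots,m,\,(2m+1)\in S_k$ (so $G_2=(13425,\emptyset,\{1,2,3\})$, $G_3=(1456237,\emptyset,\{1,\dots,5\})$, $G_4=(156782349,\emptyset,\{1,\dots,7\})$, ...).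
   Context: A Grassmannian permutation is a permutation with exactly one descent (an index $d$ with $\rho(d)>\rho(d+1)$). For a Grassmannian $\rho\in S_m$ with descent at $d$, its associated partition $\lambda(\rho)$ lies in a bounding box with $d$ rows and $m-d$ columns, with lower border the lattice path starting at the lower-left corner whose $i$-th unit step ($i=1,\dots,m$) is vertical (up) if the value $i$ occurs among $\rho(1),\dots,\rho(d)$ and horizontal (right) otherwise. A right turn of the path (vertical step followed by horizontal step) is an inner corner; a left turn (horizontal followed by vertical) is an outer corner. An outer corner is too wide if the distance upward from it to the next inner corner is smaller than the distance to the left from it to the next inner corner, and too deep if the upward distance is larger than the leftward distance. $\rho$ is too wide (resp. too deep) if $\lambda(\rho)$ has an outer corner that is too wide (resp. too deep). A bivincular pattern is a triple $(p,X,Y)$ with $p\in S_k$ and $X,Y\subseteq\{0,\dots,k\}$; an occurrence in $\rho$ is a subsequence $\rho_{i_1}\cdots\rho_{i_k}$ ($i_1<\dots<i_k$) in the same relative order as $p$ with $i_{x+1}=i_x+1$ for $x\in X$ and $j_{y+1}=j_y+1$ for $y\in Y$, where $j_1<\dots<j_k$ are the values of the subsequence sorted increasingly. -}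

module Defs where

open import Data.Nat using (ℕ; zero; suc; _+_; _*_; _∸_; _<_; _≤_; _<ᵇ_; _≡ᵇ_)
open import Data.Fin as Fin using (Fin; toℕ)
open import Data.Fin.Permutation using (Permutation′; _⟨$⟩ʳ_)
open import Data.Product using (Σ; ∃; ∃-syntax; _×_; _,_)
open import Data.Sum using (_⊎_)
open import Data.Bool using (if_then_else_)
open import Data.Empty using (⊥)
open import Relation.Binary.PropositionalEquality using (_≡_)
open import Relation.Nullary using (¬_)
open import Function.Bundles using (_⇔_)

-- Positions and values are 0-based in Fin; we use 1-based naturals as in the paper:
-- position i (Fin m) is the paper's position toℕ i + 1, and
-- val ρ i = ρ(toℕ i + 1) ∈ {1,…,m}.
val : ∀ {m} → Permutation′ m → Fin m → ℕ
val ρ i = suc (toℕ (ρ ⟨$⟩ʳ i))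

DescentAt : ∀ {m} → Permutation′ m → ℕ → Set
DescentAt {m} ρ d = Σ (Fin m) λ i → Σ (Fin m) λ j →
  (suc (toℕ i) ≡ d) × (suc (toℕ j) ≡ suc d) × (val ρ j < val ρ i)

Grassmannian : ∀ {m} → Permutation′ m → Set
Grassmannian ρ = Σ ℕ λ d → DescentAt ρ d × (∀ d' → DescentAt ρ d' → d' ≡ d)

-- Lattice path of λ(ρ) for descent d: the s-th unit step (1 ≤ s ≤ m) is
-- vertical iff the value s occurs among ρ(1),…,ρ(d), horizontal otherwise.
Vert : ∀ {m} → Permutation′ m → ℕ → ℕ → Set
Vert {m} ρ d s = Σ (Fin m) λ i → (suc (toℕ i) ≤ d) × (val ρ i ≡ s)

Horiz : ∀ {m} → Permutation′ m → ℕ → ℕ → Set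
Horiz {m} ρ d s = (1 ≤ s) × (s ≤ m) × ¬ Vert ρ d s

-- There is an outer corner between steps s and s+1 (step s horizontal,
-- step s+1 vertical); the distance upward from it to the next inner corner
-- is u (steps s+1,…,s+u vertical, followed by a horizontal step s+u+1, i.e. a
-- right turn), and the distance to the left from it to the next inner corner is
-- l (steps s-l+1,…,s horizontal, preceded by a vertical step s-l, i.e. a right turn).
OuterCorner : ∀ {m} → Permutation′ m → ℕ → (s u l : ℕ) → Set
OuterCorner ρ d s u l =
  Horiz ρ d s × Vert ρ d (suc s) ×
  (1 ≤ u) × (∀ t → s < t → t ≤ s + u → Vert ρ d t) × Horiz ρ d (suc (s + u)) ×
  (1 ≤ l) × (l < s) × (∀ t → s ∸ l < t → t ≤ s → Horiz ρ d t) × Vert ρ d (s ∸ l)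

TooWide : ∀ {m} → Permutation′ m → Set
TooWide ρ = Σ ℕ λ d → DescentAt ρ d ×
  Σ ℕ λ s → Σ ℕ λ u → Σ ℕ λ l → OuterCorner ρ d s u l × (u < l)

TooDeep : ∀ {m} → Permutation′ m → Set
TooDeep ρ = Σ ℕ λ d → DescentAt ρ d ×
  Σ ℕ λ s → Σ ℕ λ u → Σ ℕ λ l → OuterCorner ρ d s u l × (l < u)

-- A bivincular pattern (p, X, Y): p ∈ S_k given by its values p(1),…,p(k) ∈ {1,…,k}
-- (pat a = p(toℕ a + 1)), and X, Y ⊆ {0,…,k} given as predicates on ℕ.
record Bivincular : Set₁ where
  field
    k   : ℕ
    pat : Fin k → ℕ
    X   : ℕ → Set
    Y   : ℕ → Set

-- IPos x n : "i_x = n" with the usual conventions i_0 = 0, i_{k+1} = m+1.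
-- JVal y n : "j_y = n" with j_0 = 0, j_{k+1} = m+1, where j_y, the y-th smallest
--            value of the occurrence, is the value at the position a with p(a) = y.
record Occurrence {m} (ρ : Permutation′ m) (P : Bivincular) : Set where
  open Bivincular P
  field
    ι     : Fin k → Fin m
    incr  : ∀ a b → a Fin.< b → ι a Fin.< ι b
    order : ∀ a b → (val ρ (ι a) < val ρ (ι b)) ⇔ (pat a < pat b)
  IPos : ℕ → ℕ → Set
  IPos x n = ((x ≡ 0) × (n ≡ 0)) ⊎ ((x ≡ suc k) × (n ≡ suc m)) ⊎
             (Σ (Fin k) λ a → (suc (toℕ a) ≡ x) × (suc (toℕ (ι a)) ≡ n))
  JVal : ℕ → ℕ → Set
  JVal y n = ((y ≡ 0) × (n ≡ 0)) ⊎ ((y ≡ suc k) × (n ≡ suc m)) ⊎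
             (Σ (Fin k) λ a → (pat a ≡ y) × (val ρ (ι a) ≡ n))
  field
    adjX : ∀ x → X x → x ≤ k → ∀ n n' → IPos x n → IPos (suc x) n' → n' ≡ suc n
    adjY : ∀ y → Y y → y ≤ k → ∀ n n' → JVal y n → JVal (suc y) n' → n' ≡ suc n

Contains : ∀ {m} → Permutation′ m → Bivincular → Set
Contains ρ P = Occurrence ρ P

-- f_n = 1, (n+2), …, (2n), 2, 3, …, (n+1), (2n+1) ∈ S_{2n+1}   (0-based position i)
f : (n : ℕ) → Fin (suc (2 * n)) → ℕ
f n a = let i = toℕ a in
  if i ≡ᵇ 0 then 1
  else if i <ᵇ n then n + 1 + i
  else if i <ᵇ 2 * n then (i ∸ n) + 2
  else suc (2 * n)

g : (n : ℕ) → Fin (suc (2 * n)) → ℕ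
g n a = let i = toℕ a in
  if i ≡ᵇ 0 then 1
  else if i <ᵇ suc n then n + i
  else if i <ᵇ 2 * n then (i ∸ n) + 1
  else suc (2 * n)

F : ℕ → Bivincular
F n = record { k = suc (2 * n) ; pat = f n ; X = λ _ → ⊥
             ; Y = λ y → (2 ≤ y) × (y ≤ 2 * n) }

G : ℕ → Bivincular
G n = record { k = suc (2 * n) ; pat = g n ; X = λ _ → ⊥
             ; Y = λ y → (1 ≤ y) × (y ≤ 2 * n ∸ 1) }

module Submission where

-- In a Grassmannian permutation with descent d, the values at positions 1…d are exactly
-- the vertical steps of the lattice path, in increasing order, and the values after d the
-- horizontal steps, again increasing.  Both f_n and g_n are block swaps
-- 1, (a+2)…(a+b+1), 2…(a+1), (a+b+2), with a = n, b = n-1 for f_n and a = n-1, b = n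
-- for g_n.  In an occurrence the high block must lie before the descent and the low block
-- after it, so the low block sits on horizontal and the high block on vertical steps, and
-- the adjacencies required by Y make the two blocks one consecutive stretch: an outer
-- corner with l ≥ a and u ≥ b.  For F_n the last letter is adjacent as well, forcing
-- u = b < a ≤ l; for G_n the first one is, forcing l = a < b ≤ u.  Conversely, a corner
-- with u < l (or l < u) carries the block swap on the steps s-a+1…s+b, completed by the
-- vertical step s-l and the horizontal step s+u+1.

open import Defs
open import Data.Nat
  using (ℕ; zero; suc; _+_; _*_; _∸_; _<_; _≤_; _≮_; z≤n; s≤s; s≤s⁻¹; s<s⁻¹; _≤?_; _<?_; _≟_; _<ᵇ_)
open import Data.Nat.Properties
open import Data.Nat.Tactic.RingSolver using (solve-∀)
open import Data.Fin as Fin using (Fin; toℕ; fromℕ<)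
open import Data.Fin.Properties using (toℕ-injective; toℕ-fromℕ<; toℕ<n; any?)
open import Data.Fin.Permutation using (Permutation′; _⟨$⟩ʳ_; _⟨$⟩ˡ_; inverseʳ; inverseˡ)
open import Data.Product using (Σ; _×_; _,_; proj₁; proj₂)
open import Data.Sum using (_⊎_; inj₁; inj₂)
open import Data.Bool using (true; false; T)
open import Data.Unit using (tt)
open import Data.Empty using (⊥; ⊥-elim)
open import Relation.Binary.PropositionalEquality
open import Relation.Binary.Definitions using (tri<; tri≈; tri>)
open import Relation.Nullary using (¬_; yes; no; contradiction)
open import Relation.Nullary.Decidable using (_×-dec_; ¬?)
open import Relation.Unary using (Decidable)
open import Function.Bundles using (_⇔_; mk⇔; Equivalence)
open import Function.Base using (_∘_)

greatest-below : ∀ {P : ℕ → Set} → Decidable P → ∀ {z b} → z < b → P z →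
  Σ ℕ λ t → z ≤ t × t < b × P t × (∀ t′ → t < t′ → t′ < b → ¬ P t′)
greatest-below {P} P? {z} {suc b} (s≤s z≤b) pz with P? b
... | yes pb =
  b , z≤b , ≤-refl , pb , λ t′ b<t′ t′<1+b → contradiction (s≤s⁻¹ t′<1+b) (<⇒≱ b<t′)
... | no ¬pb with m≤n⇒m<n∨m≡n z≤b
...   | inj₂ refl = contradiction pz ¬pb
...   | inj₁ z<b with greatest-below P? z<b pz
...     | t , z≤t , t<b , pt , above = t , z≤t , m<n⇒m<1+n t<b , pt , above′
  where
  above′ : ∀ t′ → t < t′ → t′ < suc b → ¬ P t′
  above′ t′ t<t′ t′<1+b with m≤n⇒m<n∨m≡n (s≤s⁻¹ t′<1+b)
  ... | inj₁ t′<b = above t′ t<t′ t′<b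
  ... | inj₂ refl = ¬pb

least-above : ∀ {P : ℕ → Set} → Decidable P → ∀ {t₀ z} → t₀ ≤ z → P z →
  Σ ℕ λ t → t₀ ≤ t × t ≤ z × P t × (∀ t′ → t₀ ≤ t′ → t′ < t → ¬ P t′)
least-above {P} P? {t₀} {z} t₀≤z pz = search (z ∸ t₀) t₀ (m∸n+n≡m t₀≤z)
  where
  search : ∀ g t₁ → g + t₁ ≡ z →
    Σ ℕ λ t → t₁ ≤ t × t ≤ z × P t × (∀ t′ → t₁ ≤ t′ → t′ < t → ¬ P t′)
  search g t₁ g+t₁≡z with P? t₁
  ... | yes pt₁ = t₁ , ≤-refl , subst (t₁ ≤_) g+t₁≡z (m≤n+m t₁ g) , pt₁ ,
                  λ t′ t₁≤t′ t′<t₁ → contradiction t₁≤t′ (<⇒≱ t′<t₁)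
  search zero t₁ refl | no ¬pt₁ = contradiction pz ¬pt₁
  search (suc g) t₁ g+t₁≡z | no ¬pt₁ with search g (suc t₁) (trans (+-suc g t₁) g+t₁≡z)
  ... | t , t₁<t , t≤z , pt , below = t , <⇒≤ t₁<t , t≤z , pt , below′
    where
    below′ : ∀ t′ → t₁ ≤ t′ → t′ < t → ¬ P t′
    below′ t′ t₁≤t′ t′<t with m≤n⇒m<n∨m≡n t₁≤t′
    ... | inj₁ t₁<t′ = below t′ t₁<t′ t′<t
    ... | inj₂ refl = ¬pt₁

module OccurrenceProperties {m : ℕ} {ρ : Permutation′ m} {P : Bivincular} (O : Occurrence ρ P) where
  open Bivincular P
  open Occurrence O

  value : Fin k → ℕ
  value x = val ρ (ι x)

  value-< : ∀ x y → pat x < pat y → value x < value y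
  value-< x y = Equivalence.from (order x y)

  value-adjacent : ∀ y → Y y → y ≤ k → ∀ x x′ → pat x ≡ y → pat x′ ≡ suc y →
    value x′ ≡ suc (value x)
  value-adjacent y Yy y≤k x x′ px≡y px′≡1+y =
    adjY y Yy y≤k _ _ (inj₂ (inj₂ (x , px≡y , refl))) (inj₂ (inj₂ (x′ , px′≡1+y , refl)))

  ι-monotone : ∀ x y → toℕ x ≤ toℕ y → toℕ (ι x) ≤ toℕ (ι y)
  ι-monotone x y x≤y with m≤n⇒m<n∨m≡n x≤y
  ... | inj₁ x<y = <⇒≤ (incr x y x<y)
  ... | inj₂ x≡y = ≤-reflexive (cong (toℕ ∘ ι) (toℕ-injective x≡y))

module LatticePath {m : ℕ} (ρ : Permutation′ m) (d : ℕ) where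

  Left Right : Fin m → Set
  Left i = suc (toℕ i) ≤ d
  Right i = d < suc (toℕ i)

  val-injective : ∀ {i j} → val ρ i ≡ val ρ j → i ≡ j
  val-injective {i} {j} vi≡vj = begin
    i                    ≡⟨ inverseˡ ρ ⟨
    ρ ⟨$⟩ˡ (ρ ⟨$⟩ʳ i)    ≡⟨ cong (ρ ⟨$⟩ˡ_) (toℕ-injective (suc-injective vi≡vj)) ⟩
    ρ ⟨$⟩ˡ (ρ ⟨$⟩ʳ j)    ≡⟨ inverseˡ ρ ⟩
    j                    ∎
    where open ≡-Reasoning

  value-position : ∀ x → 1 ≤ x → x ≤ m → Σ (Fin m) λ i → val ρ i ≡ x
  value-position (suc x) _ x<m =
    ρ ⟨$⟩ˡ fromℕ< x<m , cong suc (trans (cong toℕ (inverseʳ ρ)) (toℕ-fromℕ< x<m))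

  Vert? : Decidable (Vert ρ d)
  Vert? x = any? λ i → (suc (toℕ i) ≤? d) ×-dec (val ρ i ≟ x)

  left⇒vert : ∀ i → Left i → Vert ρ d (val ρ i)
  left⇒vert i i≤d = i , i≤d , refl

  vert⇒left : ∀ i → Vert ρ d (val ρ i) → Left i
  vert⇒left i (j , j≤d , vj≡vi) = subst Left (val-injective vj≡vi) j≤d

  right⇒horiz : ∀ i → Right i → Horiz ρ d (val ρ i)
  right⇒horiz i d<i = s≤s z≤n , toℕ<n (ρ ⟨$⟩ʳ i) , λ v → <⇒≱ d<i (vert⇒left i v)

  horiz⇒right : ∀ i → Horiz ρ d (val ρ i) → Right i
  horiz⇒right i (_ , _ , ¬vert) = ≰⇒> (¬vert ∘ left⇒vert i)

  ¬horiz⇒vert : ∀ x → 1 ≤ x → x ≤ m → ¬ Horiz ρ d x → Vert ρ d x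
  ¬horiz⇒vert x 1≤x x≤m ¬horiz with Vert? x
  ... | yes vert = vert
  ... | no ¬vert = contradiction (1≤x , x≤m , ¬vert) ¬horiz

  vert⇒positive : ∀ {x} → Vert ρ d x → 1 ≤ x
  vert⇒positive (_ , _ , refl) = s≤s z≤n

  Horiz? : Decidable (Horiz ρ d)
  Horiz? x = (1 ≤? x) ×-dec ((x ≤? m) ×-dec ¬? (Vert? x))

  vertical-run-extends : ∀ {s β z′} → (∀ t → s < t → t ≤ s + β → Vert ρ d t) →
    s + β < z′ → Horiz ρ d z′ →
    Σ ℕ λ u → β ≤ u × (∀ t → s < t → t ≤ s + u → Vert ρ d t) × Horiz ρ d (suc (s + u)) ×
              (z′ ≡ suc (s + β) → u ≡ β)
  vertical-run-extends {s} {β} {z′} run s+β<z′ horiz-z′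
    with least-above Horiz? s+β<z′ horiz-z′
  ... | t₁ , s+β<t₁ , t₁≤z′ , horiz-t₁ , below
    with t₁ ∸ suc (s + β) | m+[n∸m]≡n s+β<t₁
  ... | e | refl =
    β + e , m≤m+n β e , run′ , subst (Horiz ρ d) (cong suc (+-assoc s β e)) horiz-t₁ , exact
    where
    run′ : ∀ t → s < t → t ≤ s + (β + e) → Vert ρ d t
    run′ t s<t t≤s+β+e with t ≤? s + β
    ... | yes t≤s+β = run t s<t t≤s+β
    ... | no t≰s+β = ¬horiz⇒vert t (≤-trans (s≤s z≤n) s<t)
      (≤-trans (<⇒≤ t<t₁) (≤-trans t₁≤z′ (proj₁ (proj₂ horiz-z′))))
      (below t (≰⇒> t≰s+β) t<t₁)
      where
      t<t₁ : t < suc (s + β) + e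
      t<t₁ = s≤s (subst (t ≤_) (sym (+-assoc s β e)) t≤s+β+e)
    exact : z′ ≡ suc (s + β) → β + e ≡ β
    exact refl = trans (cong (β +_) (n≤0⇒n≡0 (+-cancelˡ-≤ (suc (s + β)) e 0
                   (subst (suc (s + β) + e ≤_) (sym (+-identityʳ _)) t₁≤z′)))) (+-identityʳ β)

  horizontal-run-extends : ∀ {s B z} → (∀ t → B ≤ t → t ≤ s → Horiz ρ d t) →
    B ≤ s → z < B → Vert ρ d z →
    Σ ℕ λ l → s < l + B × l < s × (∀ t → s ∸ l < t → t ≤ s → Horiz ρ d t) ×
              Vert ρ d (s ∸ l) × (suc z ≡ B → l ≡ s ∸ z)
  horizontal-run-extends {s} {B} {z} run B≤s z<B vert-z
    with greatest-below Vert? z<B vert-z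
  ... | t₀ , z≤t₀ , t₀<B , vert-t₀ , above =
    s ∸ t₀ ,
    subst (_< s ∸ t₀ + B) (m∸n+n≡m t₀≤s) (+-monoʳ-< (s ∸ t₀) t₀<B) ,
    ∸-monoʳ-< (vert⇒positive vert-t₀) t₀≤s ,
    run′ ,
    subst (Vert ρ d) (sym (m∸[m∸n]≡n t₀≤s)) vert-t₀ ,
    λ 1+z≡B → cong (s ∸_) (≤-antisym (s≤s⁻¹ (subst (t₀ <_) (sym 1+z≡B) t₀<B)) z≤t₀)
    where
    t₀≤s : t₀ ≤ s
    t₀≤s = ≤-trans (<⇒≤ t₀<B) B≤s
    run′ : ∀ t → s ∸ (s ∸ t₀) < t → t ≤ s → Horiz ρ d t
    run′ t s∸l<t t≤s with B ≤? t
    ... | yes B≤t = run t B≤t t≤s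
    ... | no B≰t = ≤-trans (s≤s z≤n) t₀<t , ≤-trans t≤s (proj₁ (proj₂ (run s B≤s ≤-refl))) ,
                   above t t₀<t (≰⇒> B≰t)
      where
      t₀<t : t₀ < t
      t₀<t = subst (_< t) (m∸[m∸n]≡n t₀≤s) s∸l<t

module SingleDescent {m : ℕ} (ρ : Permutation′ m) {d : ℕ}
  (only-descent : ∀ d′ → DescentAt ρ d′ → d′ ≡ d) where
  open LatticePath ρ d public

  ascent : ∀ (i j : Fin m) → suc (toℕ i) ≡ toℕ j → suc (toℕ i) ≢ d → val ρ i < val ρ j
  ascent i j i+1≡j i+1≢d with <-cmp (val ρ i) (val ρ j)
  ... | tri< vi<vj _ _ = vi<vj
  ... | tri≈ _ vi≡vj _ = contradiction (trans i+1≡j (cong toℕ (val-injective (sym vi≡vj)))) 1+n≢n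
  ... | tri> _ _ vj<vi =
    contradiction (only-descent _ (i , j , refl , cong suc (sym i+1≡j) , vj<vi)) i+1≢d

  increasing-by-gap : ∀ g (i j : Fin m) → toℕ j ≡ suc (g + toℕ i) →
    (∀ (p : Fin m) → toℕ i ≤ toℕ p → toℕ p < toℕ j → suc (toℕ p) ≢ d) → val ρ i < val ρ j
  increasing-by-gap zero i j j≡1+i no-descent =
    ascent i j (sym j≡1+i) (no-descent i ≤-refl (≤-reflexive (sym j≡1+i)))
  increasing-by-gap (suc g) i j j≡2+g+i no-descent =
    <-trans (increasing-by-gap g i q q≡1+g+i (λ p i≤p p<q → no-descent p i≤p (<-trans p<q q<j)))
            (ascent q j (trans (cong suc q≡1+g+i) (sym j≡2+g+i)) (no-descent q i≤q q<j))
    where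
    q<m : suc (g + toℕ i) < m
    q<m = <-trans (n<1+n _) (subst (_< m) j≡2+g+i (toℕ<n j))
    q : Fin m
    q = fromℕ< q<m
    q≡1+g+i : toℕ q ≡ suc (g + toℕ i)
    q≡1+g+i = toℕ-fromℕ< q<m
    q<j : toℕ q < toℕ j
    q<j = ≤-reflexive (trans (cong suc q≡1+g+i) (sym j≡2+g+i))
    i≤q : toℕ i ≤ toℕ q
    i≤q = subst (toℕ i ≤_) (sym q≡1+g+i) (m≤n+m (toℕ i) (suc g))

  increasing-between : ∀ (i j : Fin m) → toℕ i < toℕ j →
    (∀ (p : Fin m) → toℕ i ≤ toℕ p → toℕ p < toℕ j → suc (toℕ p) ≢ d) → val ρ i < val ρ j
  increasing-between i j i<j = increasing-by-gap (toℕ j ∸ suc (toℕ i)) i j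
    (trans (sym (m∸n+n≡m i<j)) (+-suc (toℕ j ∸ suc (toℕ i)) (toℕ i)))

  increasing-left : ∀ i j → toℕ i < toℕ j → Left j → val ρ i < val ρ j
  increasing-left i j i<j j≤d = increasing-between i j i<j
    λ p _ p<j p+1≡d → <-irrefl p+1≡d (<-≤-trans (s≤s p<j) j≤d)

  increasing-right : ∀ i j → toℕ i < toℕ j → Right i → val ρ i < val ρ j
  increasing-right i j i<j d≤i = increasing-between i j i<j
    λ p i≤p _ p+1≡d → <-irrefl (sym p+1≡d) (<-≤-trans d≤i (s≤s i≤p))

  inversion-straddles : ∀ i j → toℕ i < toℕ j → val ρ j < val ρ i → Left i × Right j
  inversion-straddles i j i<j vj<vi with suc (toℕ i) ≤? d | suc (toℕ j) ≤? d
  ... | no i≰d | _ = contradiction (increasing-right i j i<j (≰⇒> i≰d)) (<-asym vj<vi)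
  ... | yes _ | yes j≤d = contradiction (increasing-left i j i<j j≤d) (<-asym vj<vi)
  ... | yes i≤d | no j≰d = i≤d , ≰⇒> j≰d

  ordered-by-value : ∀ i j → val ρ i < val ρ j → (Left i × Left j) ⊎ (Right i × Right j) →
    toℕ i < toℕ j
  ordered-by-value i j vi<vj same-run with <-cmp (toℕ i) (toℕ j)
  ... | tri< i<j _ _ = i<j
  ... | tri≈ _ i≡j _ = contradiction (cong (val ρ) (toℕ-injective i≡j)) (<⇒≢ vi<vj)
  ... | tri> _ _ j<i = contradiction vi<vj (<-asym (descending same-run))
    where
    descending : (Left i × Left j) ⊎ (Right i × Right j) → val ρ j < val ρ i
    descending (inj₁ (i≤d , _)) = increasing-left j i j<i i≤d
    descending (inj₂ (_ , d<j)) = increasing-right j i j<i d<j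

  module _ {P : Bivincular} (O : Occurrence ρ P) where
    open Bivincular P
    open Occurrence O
    open OccurrenceProperties O

    inversion-splits : ∀ x y → toℕ x < toℕ y → pat y < pat x →
      (∀ z → toℕ z ≤ toℕ x → Left (ι z)) × (∀ z → toℕ y ≤ toℕ z → Right (ι z))
    inversion-splits x y x<y py<px
      with inversion-straddles (ι x) (ι y) (incr x y x<y) (value-< y x py<px)
    ... | x-left , y-right =
      (λ z z≤x → ≤-trans (s≤s (ι-monotone z x z≤x)) x-left) ,
      (λ z y≤z → <-≤-trans y-right (s≤s (ι-monotone y z y≤z)))

  module Embedding {k : ℕ} (pat : Fin k → ℕ) (Y : ℕ → Set) (φ : ℕ → ℕ) (c : ℕ)
    (first-run-increasing : ∀ x y → toℕ x < toℕ y → toℕ y < c → pat x < pat y)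
    (second-run-increasing : ∀ x y → toℕ x < toℕ y → c ≤ toℕ x → pat x < pat y)
    (φ-increasing : ∀ x y → pat x < pat y → φ (pat x) < φ (pat y))
    (first-run-vert : ∀ x → toℕ x < c → Vert ρ d (φ (pat x)))
    (second-run-horiz : ∀ x → c ≤ toℕ x → Horiz ρ d (φ (pat x)))
    (Y-bounds : ∀ y → Y y → 1 ≤ y × y < k)
    (φ-adjacent : ∀ y → Y y → φ (suc y) ≡ suc (φ y))
    where

    position : ∀ x → Σ (Fin m) λ i → val ρ i ≡ φ (pat x)
    position x with toℕ x <? c
    ... | yes x<c = let (i , _ , vi≡φx) = first-run-vert x x<c in i , vi≡φx
    ... | no x≮c = let (1≤φx , φx≤m , _) = second-run-horiz x (≮⇒≥ x≮c)
                   in value-position _ 1≤φx φx≤m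

    ι : Fin k → Fin m
    ι x = proj₁ (position x)

    ι-value : ∀ x → val ρ (ι x) ≡ φ (pat x)
    ι-value x = proj₂ (position x)

    ι-left : ∀ x → toℕ x < c → Left (ι x)
    ι-left x x<c = vert⇒left (ι x) (subst (Vert ρ d) (sym (ι-value x)) (first-run-vert x x<c))

    ι-right : ∀ x → c ≤ toℕ x → Right (ι x)
    ι-right x c≤x = horiz⇒right (ι x) (subst (Horiz ρ d) (sym (ι-value x)) (second-run-horiz x c≤x))

    value-increasing : ∀ x y → pat x < pat y → val ρ (ι x) < val ρ (ι y)
    value-increasing x y px<py = subst₂ _<_ (sym (ι-value x)) (sym (ι-value y)) (φ-increasing x y px<py)

    cut-cases : ∀ i j → i < j → j < c ⊎ c ≤ i ⊎ (i < c × c ≤ j)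
    cut-cases i j i<j with j <? c | c ≤? i
    ... | yes j<c | _ = inj₁ j<c
    ... | no _ | yes c≤i = inj₂ (inj₁ c≤i)
    ... | no j≮c | no c≰i = inj₂ (inj₂ (≰⇒> c≰i , ≮⇒≥ j≮c))

    incr : ∀ x y → x Fin.< y → ι x Fin.< ι y
    incr x y x<y with cut-cases (toℕ x) (toℕ y) x<y
    ... | inj₁ y<c = ordered-by-value (ι x) (ι y)
      (value-increasing x y (first-run-increasing x y x<y y<c))
      (inj₁ (ι-left x (<-trans x<y y<c) , ι-left y y<c))
    ... | inj₂ (inj₁ c≤x) = ordered-by-value (ι x) (ι y)
      (value-increasing x y (second-run-increasing x y x<y c≤x))
      (inj₂ (ι-right x c≤x , ι-right y (≤-trans c≤x (<⇒≤ x<y))))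
    ... | inj₂ (inj₂ (x<c , c≤y)) = s<s⁻¹ (≤-<-trans (ι-left x x<c) (ι-right y c≤y))

    order : ∀ x y → (val ρ (ι x) < val ρ (ι y)) ⇔ (pat x < pat y)
    order x y = mk⇔ pattern-increasing (value-increasing x y)
      where
      pattern-increasing : val ρ (ι x) < val ρ (ι y) → pat x < pat y
      pattern-increasing vx<vy with <-cmp (pat x) (pat y)
      ... | tri< px<py _ _ = px<py
      ... | tri≈ _ px≡py _ =
        contradiction (trans (ι-value x) (trans (cong φ px≡py) (sym (ι-value y)))) (<⇒≢ vx<vy)
      ... | tri> _ _ py<px = contradiction vx<vy (<-asym (value-increasing y x py<px))

    occurrence : Occurrence ρ (record { k = k ; pat = pat ; X = λ _ → ⊥ ; Y = Y })
    occurrence = record { ι = ι ; incr = incr ; order = order ; adjX = λ _ () ; adjY = λ where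
      y Yy _ _ _ (inj₁ (refl , _)) _ → contradiction (proj₁ (Y-bounds y Yy)) λ ()
      y Yy _ _ _ (inj₂ (inj₁ (refl , _))) _ →
        contradiction (proj₂ (Y-bounds y Yy)) (n≮n _ ∘ <-trans (n<1+n k))
      _ _ _ _ _ (inj₂ (inj₂ _)) (inj₁ (() , _))
      y Yy _ _ _ (inj₂ (inj₂ _)) (inj₂ (inj₁ (refl , _))) →
        contradiction (proj₂ (Y-bounds y Yy)) (n≮n k)
      y Yy _ _ _ (inj₂ (inj₂ (x , refl , refl))) (inj₂ (inj₂ (x′ , px′≡1+px , refl))) →
        trans (ι-value x′) (trans (cong φ px′≡1+px)
          (trans (φ-adjacent (pat x) Yy) (cong suc (sym (ι-value x))))) }

-- BlockSwap a b i v: the pattern 1, (a+2)…(a+b+1), 2…(a+1), (a+b+2) has the letter v at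
-- the 0-based index i.
data BlockSwap (a b : ℕ) : ℕ → ℕ → Set where
  start : BlockSwap a b 0 1
  high  : ∀ {j} → j < b → BlockSwap a b (suc j) (2 + a + j)
  low   : ∀ {j} → j < a → BlockSwap a b (suc (b + j)) (2 + j)
  end   : BlockSwap a b (suc (a + b)) (2 + a + b)

blockSwap-functional : ∀ {a b i i′ v v′} → BlockSwap a b i v → BlockSwap a b i′ v′ →
  i ≡ i′ → v ≡ v′
blockSwap-functional start start refl = refl
blockSwap-functional (high _) (high _) i≡i′ = cong (2 + _ +_) (suc-injective i≡i′)
blockSwap-functional (low _) (low _) i≡i′ = cong (2 +_) (+-cancelˡ-≡ _ _ _ (suc-injective i≡i′))
blockSwap-functional end end refl = refl
blockSwap-functional {b = b} (high j<b) (low {j′} _) i≡i′ =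
  contradiction (subst (_< b) (suc-injective i≡i′) j<b) (m+n≮m b j′)
blockSwap-functional {a} {b} (high j<b) end i≡i′ =
  contradiction (subst (_< b) (suc-injective i≡i′) j<b) (m+n≮n a b)
blockSwap-functional {b = b} (low {j} _) (high j′<b) i≡i′ =
  contradiction (subst (_< b) (suc-injective (sym i≡i′)) j′<b) (m+n≮m b j)
blockSwap-functional {a} {b} (low j<a) end i≡i′ =
  contradiction (subst (_< a) (+-cancelˡ-≡ b _ _ (trans (suc-injective i≡i′) (+-comm a b))) j<a) (n≮n a)
blockSwap-functional {a} {b} end (high j′<b) i≡i′ =
  contradiction (subst (_< b) (suc-injective (sym i≡i′)) j′<b) (m+n≮n a b)
blockSwap-functional {a} {b} end (low j′<a) i≡i′ =
  contradiction (subst (_< a) (+-cancelˡ-≡ b _ _ (trans (suc-injective (sym i≡i′)) (+-comm a b))) j′<a)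
    (n≮n a)

blockSwap-first-increasing : ∀ {a b i i′ v v′} → BlockSwap a b i v → BlockSwap a b i′ v′ →
  i < i′ → i′ ≤ b → v < v′
blockSwap-first-increasing start (high _) _ _ = s≤s (s≤s z≤n)
blockSwap-first-increasing {a} (high _) (high _) (s≤s j<j′) _ = +-monoʳ-< (2 + a) j<j′
blockSwap-first-increasing {b = b} _ (low {j′} _) _ i′≤b = contradiction i′≤b (m+n≮m b j′)
blockSwap-first-increasing {a} {b} _ end _ i′≤b = contradiction i′≤b (m+n≮n a b)
blockSwap-first-increasing {b = b} (low {j} _) (high j′<b) i<i′ _ =
  contradiction (<-trans (s≤s⁻¹ i<i′) j′<b) (m+n≮m b j)
blockSwap-first-increasing {a} {b} end (high j′<b) i<i′ _ =
  contradiction (<-trans (s≤s⁻¹ i<i′) j′<b) (m+n≮n a b)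

blockSwap-second-increasing : ∀ {a b i i′ v v′} → BlockSwap a b i v → BlockSwap a b i′ v′ →
  i < i′ → b < i → v < v′
blockSwap-second-increasing {b = b} (low _) (low _) i<i′ _ =
  s≤s (s≤s (+-cancelˡ-< b _ _ (s≤s⁻¹ i<i′)))
blockSwap-second-increasing {a} {b} (low j<a) end _ _ = s≤s (s≤s (≤-trans j<a (m≤m+n a b)))
blockSwap-second-increasing (high j<b) _ _ b<i = contradiction (s≤s⁻¹ b<i) (<⇒≱ j<b)
blockSwap-second-increasing {b = b} (low {j} _) (high j′<b) i<i′ _ =
  contradiction (<-trans (s≤s⁻¹ i<i′) j′<b) (m+n≮m b j)
blockSwap-second-increasing {a} {b} end (high j′<b) i<i′ _ =
  contradiction (<-trans (s≤s⁻¹ i<i′) j′<b) (m+n≮n a b)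
blockSwap-second-increasing {a} {b} end (low {j′} j′<a) i<i′ _ =
  contradiction (<-≤-trans (s≤s⁻¹ i<i′) (≤-reflexive (+-comm b j′))) (<-asym (+-monoˡ-< b j′<a))
blockSwap-second-increasing end end i<i′ _ = contradiction i<i′ (n≮n _)

blockSwap-bounds : ∀ {a b i v} → BlockSwap a b i v → 1 ≤ v × v ≤ 2 + a + b
blockSwap-bounds start = s≤s z≤n , s≤s z≤n
blockSwap-bounds {a} (high j<b) = s≤s z≤n , s≤s (s≤s (+-monoʳ-≤ a (<⇒≤ j<b)))
blockSwap-bounds {a} {b} (low j<a) = s≤s z≤n , s≤s (s≤s (≤-trans (<⇒≤ j<a) (m≤m+n a b)))
blockSwap-bounds end = s≤s z≤n , ≤-refl

index-segments : ∀ a b i → i ≤ suc (a + b) →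
  i ≡ 0 ⊎ (Σ ℕ λ j → j < b × i ≡ suc j) ⊎ (Σ ℕ λ j → j < a × i ≡ suc (b + j)) ⊎
  i ≡ suc (a + b)
index-segments a b zero _ = inj₁ refl
index-segments a b (suc i) i≤a+b with i <? b
... | yes i<b = inj₂ (inj₁ (i , i<b , refl))
... | no i≮b with i ∸ b <? a
...   | yes j<a = inj₂ (inj₂ (inj₁ (i ∸ b , j<a , cong suc (sym (m+[n∸m]≡n (≮⇒≥ i≮b))))))
...   | no j≮a = inj₂ (inj₂ (inj₂ (cong suc (≤-antisym (s≤s⁻¹ i≤a+b) a+b≤i))))
  where
  a+b≤i : a + b ≤ i
  a+b≤i = subst (a + b ≤_) (m∸n+n≡m (≮⇒≥ i≮b)) (+-monoˡ-≤ b (≮⇒≥ j≮a))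

<ᵇ-true : ∀ {m n} → m < n → (m <ᵇ n) ≡ true
<ᵇ-true {m} {n} m<n with m <ᵇ n in eq
... | true = refl
... | false = ⊥-elim (subst T eq (<⇒<ᵇ m<n))

<ᵇ-false : ∀ {m n} → m ≮ n → (m <ᵇ n) ≡ false
<ᵇ-false {m} {n} m≮n with m <ᵇ n in eq
... | false = refl
... | true = contradiction (<ᵇ⇒< m n (subst T (sym eq) tt)) m≮n

2*[1+n]≡2+[n+n] : ∀ n → 2 * suc n ≡ 2 + (n + n)
2*[1+n]≡2+[n+n] n = cong suc (trans (+-suc n (n + 0)) (cong (suc ∘ (n +_)) (+-identityʳ n)))

1+2*[1+n]≡2+n+[1+n] : ∀ n → suc (2 * suc n) ≡ 2 + n + suc n
1+2*[1+n]≡2+n+[1+n] n = trans (cong suc (2*[1+n]≡2+[n+n] n)) (cong (2 +_) (sym (+-suc n n)))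

2*[1+n]∸1≡n+[1+n] : ∀ n → 2 * suc n ∸ 1 ≡ n + suc n
2*[1+n]∸1≡n+[1+n] n = cong (λ t → n + suc t) (+-identityʳ n)

-- After rewriting the index the conditionals of f and g compute; the comparisons left over
-- appear in normal form, with 2 * suc u unfolded to suc (u + suc (u + 0)).
f-blockSwap : ∀ u (x : Fin (suc (2 * suc u))) → BlockSwap (suc u) u (toℕ x) (f (suc u) x)
f-blockSwap u x
  with index-segments (suc u) u (toℕ x) (subst (toℕ x ≤_) (2*[1+n]≡2+[n+n] u) (s≤s⁻¹ (toℕ<n x)))
... | inj₁ x≡0 rewrite x≡0 = start
... | inj₂ (inj₁ (j , j<u , x≡1+j)) rewrite x≡1+j | <ᵇ-true j<u =
  subst (BlockSwap (suc u) u (suc j)) (high-value u j) (high j<u)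
  where
  high-value : ∀ u j → 2 + suc u + j ≡ suc (u + 1 + suc j)
  high-value = solve-∀
... | inj₂ (inj₂ (inj₁ (j , j≤u , x≡1+u+j))) rewrite x≡1+u+j | <ᵇ-false (m+n≮m u j)
  | <ᵇ-true {u + j} {u + suc (u + 0)} (+-monoʳ-< u (subst (j <_) (cong suc (sym (+-identityʳ u))) j≤u)) =
  subst (BlockSwap (suc u) u (suc (u + j))) (trans (+-comm 2 j) (cong (_+ 2) (sym (m+n∸m≡n u j)))) (low j≤u)
... | inj₂ (inj₂ (inj₂ x≡end)) rewrite x≡end | <ᵇ-false (m+n≮n (suc u) u)
  | <ᵇ-false (λ p → n≮n _ (subst (suc (u + u) <_) (suc-injective (2*[1+n]≡2+[n+n] u)) p)) =
  subst (BlockSwap (suc u) u (suc (suc u + u))) (cong suc (sym (2*[1+n]≡2+[n+n] u))) end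

g-blockSwap : ∀ l (x : Fin (suc (2 * suc l))) → BlockSwap l (suc l) (toℕ x) (g (suc l) x)
g-blockSwap l x
  with index-segments l (suc l) (toℕ x)
         (subst (toℕ x ≤_) (suc-injective (1+2*[1+n]≡2+n+[1+n] l)) (s≤s⁻¹ (toℕ<n x)))
... | inj₁ x≡0 rewrite x≡0 = start
... | inj₂ (inj₁ (j , j≤l , x≡1+j)) rewrite x≡1+j | <ᵇ-true j≤l =
  subst (BlockSwap l (suc l) (suc j)) (sym (+-suc (suc l) j)) (high j≤l)
... | inj₂ (inj₂ (inj₁ (j , j<l , x≡2+l+j))) rewrite x≡2+l+j | <ᵇ-false (m+n≮m l j)
  | <ᵇ-true {suc (l + j)} {l + suc (l + 0)}
      (subst (_< l + suc (l + 0)) (+-suc l j) (+-monoʳ-< l (s≤s (subst (j <_) (sym (+-identityʳ l)) j<l)))) =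
  subst (BlockSwap l (suc l) (suc (suc (l + j))))
    (sym (trans (cong (_+ 1) 1+l+j∸l≡1+j) (+-comm (suc j) 1)))
    (low j<l)
  where
  1+l+j∸l≡1+j : suc (l + j) ∸ l ≡ suc j
  1+l+j∸l≡1+j = trans (cong (_∸ l) (sym (+-suc l j))) (m+n∸m≡n l (suc j))
... | inj₂ (inj₂ (inj₂ x≡end)) rewrite x≡end | <ᵇ-false (m+n≮n l (suc l))
  | <ᵇ-false (λ p → n≮n _ (subst (l + suc l <_) (cong (λ t → l + suc t) (+-identityʳ l)) p)) =
  subst (BlockSwap l (suc l) (suc (l + suc l))) (cong (λ t → 2 + (l + suc t)) (sym (+-identityʳ l))) end

module CornerToBlockSwap {m : ℕ} (ρ : Permutation′ m) {d : ℕ}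
  (only-descent : ∀ d′ → DescentAt ρ d′ → d′ ≡ d)
  {a b c u l : ℕ} (1≤a : 1 ≤ a) (a≤l : a ≤ l) (b≤u : b ≤ u)
  (vertical-run : ∀ t → suc (a + c) < t → t ≤ suc (a + c) + u → Vert ρ d t)
  (top : Horiz ρ d (suc (suc (a + c) + u)))
  (horizontal-run : ∀ t → suc (a + c) ∸ l < t → t ≤ suc (a + c) → Horiz ρ d t)
  (bottom : Vert ρ d (suc (a + c) ∸ l)) where
  open SingleDescent ρ only-descent

  s : ℕ
  s = suc (a + c)

  -- Letter 1 goes to the vertical step below the horizontal run, the letters 2…a+b+1 to
  -- the steps s-a+1…s+b around the corner, the last letter to the horizontal step above
  -- the vertical run.
  φ : ℕ → ℕ
  φ (suc (suc y)) with suc y ≤? a + b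
  ... | yes _ = 2 + y + c
  ... | no _ = suc (s + u)
  φ _ = s ∸ l

  φ-middle : ∀ y → 2 ≤ y → y ≤ suc (a + b) → φ y ≡ y + c
  φ-middle (suc (suc y)) _ y≤1+a+b with suc y ≤? a + b
  ... | yes _ = refl
  ... | no y≰a+b = contradiction (s≤s⁻¹ y≤1+a+b) y≰a+b
  φ-middle (suc zero) (s≤s ()) _

  φ-last : φ (2 + a + b) ≡ suc (s + u)
  φ-last with suc (a + b) ≤? a + b
  ... | yes 1+a+b≤a+b = contradiction 1+a+b≤a+b 1+n≰n
  ... | no _ = refl

  s∸a≡1+c : s ∸ a ≡ suc c
  s∸a≡1+c = trans (cong (_∸ a) (sym (+-suc a c))) (m+n∸m≡n a (suc c))

  s∸l≤1+c : s ∸ l ≤ suc c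
  s∸l≤1+c = subst (s ∸ l ≤_) s∸a≡1+c (∸-monoʳ-≤ s a≤l)

  2≤1+a+b : 2 ≤ suc (a + b)
  2≤1+a+b = s≤s (≤-trans 1≤a (m≤m+n a b))

  last-middle : suc (a + b) + c ≡ s + b
  last-middle = shuffle a b c
    where
    shuffle : ∀ a b c → suc (a + b) + c ≡ suc (a + c) + b
    shuffle = solve-∀

  φ-increasing : ∀ v w → 1 ≤ v → v < w → w ≤ 2 + a + b → φ v < φ w
  φ-increasing (suc zero) w _ 1<w w≤2+a+b with m≤n⇒m<n∨m≡n w≤2+a+b
  ... | inj₁ (s≤s w≤1+a+b) = <-≤-trans (s≤s s∸l≤1+c)
    (subst (2 + c ≤_) (sym (φ-middle w 1<w w≤1+a+b)) (+-monoˡ-≤ c 1<w))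
  ... | inj₂ refl = subst (s ∸ l <_) (sym φ-last) (s≤s (≤-trans (m∸n≤m s l) (m≤m+n s u)))
  φ-increasing (suc (suc v)) w _ v<w w≤2+a+b with m≤n⇒m<n∨m≡n w≤2+a+b
  ... | inj₁ (s≤s w≤1+a+b) = subst₂ _<_
    (sym (φ-middle (2 + v) (s≤s (s≤s z≤n)) (≤-trans (<⇒≤ v<w) w≤1+a+b)))
    (sym (φ-middle w (≤-trans (s≤s (s≤s z≤n)) (<⇒≤ v<w)) w≤1+a+b))
    (+-monoˡ-< c v<w)
  ... | inj₂ refl = subst₂ _<_
    (sym (φ-middle (2 + v) (s≤s (s≤s z≤n)) (s≤s⁻¹ v<w))) (sym φ-last)
    (s≤s (≤-trans (+-monoˡ-≤ c (s≤s⁻¹ v<w))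
               (≤-trans (≤-reflexive last-middle) (+-monoʳ-≤ s b≤u))))

  vert-of-first : ∀ {i v} → BlockSwap a b i v → i ≤ b → Vert ρ d (φ v)
  vert-of-first start _ = bottom
  vert-of-first (high {j} j<b) _ =
    subst (Vert ρ d) (sym (trans (φ-middle (2 + a + j) (s≤s (s≤s z≤n)) 2+a+j≤1+a+b) (shift a j c)))
      (vertical-run (s + suc j) (m<m+n s (s≤s z≤n)) (+-monoʳ-≤ s (≤-trans j<b b≤u)))
    where
    2+a+j≤1+a+b : 2 + a + j ≤ suc (a + b)
    2+a+j≤1+a+b = s≤s (subst (_≤ a + b) (+-suc a j) (+-monoʳ-≤ a j<b))
    shift : ∀ a j c → 2 + a + j + c ≡ suc (a + c) + suc j
    shift = solve-∀
  vert-of-first (low {j} _) i≤b = contradiction i≤b (m+n≮m b j)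
  vert-of-first end i≤b = contradiction i≤b (m+n≮n a b)

  horiz-of-second : ∀ {i v} → BlockSwap a b i v → b < i → Horiz ρ d (φ v)
  horiz-of-second (high j<b) b<i = contradiction (s≤s⁻¹ b<i) (<⇒≱ j<b)
  horiz-of-second (low {j} j<a) _ =
    subst (Horiz ρ d) (sym (φ-middle (2 + j) (s≤s (s≤s z≤n)) (s≤s (≤-trans j<a (m≤m+n a b)))))
      (horizontal-run (2 + j + c) (<-≤-trans (s≤s s∸l≤1+c) (s≤s (s≤s (m≤n+m c j))))
                                  (s≤s (+-monoˡ-≤ c j<a)))
  horiz-of-second end _ = subst (Horiz ρ d) (sym φ-last) top

  φ-step : ∀ y → 1 ≤ y → y ≤ suc (a + b) →
    (y ≡ 1 → a ≡ l) → (y ≡ suc (a + b) → b ≡ u) → φ (suc y) ≡ suc (φ y)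
  φ-step y 1≤y y≤1+a+b first last with m≤n⇒m<n∨m≡n y≤1+a+b | m≤n⇒m<n∨m≡n 1≤y
  ... | inj₂ refl | _ = begin
    φ (2 + a + b)          ≡⟨ φ-last ⟩
    suc (s + u)            ≡⟨ cong (suc ∘ (s +_)) (sym (last refl)) ⟩
    suc (s + b)            ≡⟨ cong suc (sym last-middle) ⟩
    suc (suc (a + b) + c)  ≡⟨ cong suc (sym (φ-middle _ 2≤1+a+b ≤-refl)) ⟩
    suc (φ (suc (a + b)))  ∎
    where open ≡-Reasoning
  ... | inj₁ _ | inj₂ refl = begin
    φ 2           ≡⟨ φ-middle 2 ≤-refl 2≤1+a+b ⟩
    suc (suc c)   ≡⟨ cong suc (sym s∸a≡1+c) ⟩
    suc (s ∸ a)   ≡⟨ cong (suc ∘ (s ∸_)) (first refl) ⟩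
    suc (φ 1)     ∎
    where open ≡-Reasoning
  ... | inj₁ (s≤s y≤a+b) | inj₁ 1<y =
    trans (φ-middle (suc y) (≤-trans 1<y (n≤1+n y)) (s≤s y≤a+b))
          (cong suc (sym (φ-middle y 1<y (≤-trans y≤a+b (n≤1+n _)))))

  occurrence : ∀ {k} (pat : Fin k → ℕ) → (∀ x → BlockSwap a b (toℕ x) (pat x)) →
    k ≡ 2 + a + b →
    (Y : ℕ → Set) → (∀ y → Y y → 1 ≤ y × y ≤ suc (a + b)) →
    (Y 1 → a ≡ l) → (Y (suc (a + b)) → b ≡ u) →
    Occurrence ρ (record { k = k ; pat = pat ; X = λ _ → ⊥ ; Y = Y })
  occurrence pat shape size Y Y-bounds Y-first Y-last = Embedding.occurrence pat Y φ (suc b)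
    (λ x y x<y y<1+b → blockSwap-first-increasing (shape x) (shape y) x<y (s≤s⁻¹ y<1+b))
    (λ x y x<y 1+b≤x → blockSwap-second-increasing (shape x) (shape y) x<y 1+b≤x)
    (λ x y px<py → φ-increasing (pat x) (pat y) (proj₁ (blockSwap-bounds (shape x))) px<py
                     (proj₂ (blockSwap-bounds (shape y))))
    (λ x x<1+b → vert-of-first (shape x) (s≤s⁻¹ x<1+b))
    (λ x 1+b≤x → horiz-of-second (shape x) 1+b≤x)
    (λ y Yy → proj₁ (Y-bounds y Yy) , subst (y <_) (sym size) (s≤s (proj₂ (Y-bounds y Yy))))
    (λ y Yy → φ-step y (proj₁ (Y-bounds y Yy)) (proj₂ (Y-bounds y Yy))
                (λ { refl → Y-first Yy }) (λ { refl → Y-last Yy }))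

corner⇒blockSwap : ∀ {m} (ρ : Permutation′ m) {d} → (∀ d′ → DescentAt ρ d′ → d′ ≡ d) →
  ∀ {s u l a b} → OuterCorner ρ d s u l → 1 ≤ a → a ≤ l → b ≤ u →
  ∀ {k} (pat : Fin k → ℕ) → (∀ x → BlockSwap a b (toℕ x) (pat x)) → k ≡ 2 + a + b →
  (Y : ℕ → Set) → (∀ y → Y y → 1 ≤ y × y ≤ suc (a + b)) →
  (Y 1 → a ≡ l) → (Y (suc (a + b)) → b ≡ u) →
  Occurrence ρ (record { k = k ; pat = pat ; X = λ _ → ⊥ ; Y = Y })
corner⇒blockSwap ρ only-descent {s} {a = a}
  (_ , _ , _ , vertical-run , top , _ , l<s , horizontal-run , bottom) 1≤a a≤l b≤u
  with s ∸ suc a | m+[n∸m]≡n (≤-<-trans a≤l l<s)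
... | c | refl =
  CornerToBlockSwap.occurrence ρ only-descent 1≤a a≤l b≤u vertical-run top horizontal-run bottom

module BlockSwapToCorner {m : ℕ} (ρ : Permutation′ m) {d : ℕ}
  (only-descent : ∀ d′ → DescentAt ρ d′ → d′ ≡ d)
  {P : Bivincular} (O : Occurrence ρ P) {a b : ℕ}
  (shape : ∀ x → BlockSwap (suc a) (suc b) (toℕ x) (Bivincular.pat P x))
  (size : Bivincular.k P ≡ 2 + suc a + suc b)
  (Y-middle : ∀ y → 2 ≤ y → y ≤ suc a + suc b → Bivincular.Y P y) where
  open Bivincular P
  open Occurrence O
  open OccurrenceProperties O
  open SingleDescent ρ only-descent

  α β : ℕ
  α = suc a
  β = suc b

  index : ∀ i → i ≤ suc (α + β) → Σ (Fin k) λ x → toℕ x ≡ i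
  index i i≤1+α+β = fromℕ< i<k , toℕ-fromℕ< i<k
    where
    i<k : i < k
    i<k = subst (i <_) (sym size) (s≤s i≤1+α+β)

  adjacent : ∀ y → 2 ≤ y → y ≤ α + β → ∀ x x′ → pat x ≡ y → pat x′ ≡ suc y →
    value x′ ≡ suc (value x)
  adjacent y 2≤y y≤α+β = value-adjacent y (Y-middle y 2≤y y≤α+β)
    (subst (y ≤_) (sym size) (≤-trans y≤α+β (≤-trans (n≤1+n _) (n≤1+n _))))

  low-index : ∀ j → j < α → Σ (Fin k) λ x → toℕ x ≡ suc (β + j)
  low-index j j<α = index _ (s≤s (subst (β + j ≤_) (+-comm β α) (+-monoʳ-≤ β (<⇒≤ j<α))))

  high-index : ∀ j → j < β → Σ (Fin k) λ x → toℕ x ≡ suc j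
  high-index j j<β = index _ (s≤s (≤-trans (<⇒≤ j<β) (m≤n+m β α)))

  B : ℕ
  B = value (proj₁ (low-index 0 (s≤s z≤n)))

  low-value : ∀ j → j < α → ∀ x → toℕ x ≡ suc (β + j) → value x ≡ j + B
  low-value zero _ x x≡1+β+0 =
    cong value (toℕ-injective (trans x≡1+β+0 (sym (proj₂ (low-index 0 (s≤s z≤n))))))
  low-value (suc j) 1+j<α x x≡2+β+j with low-index j (<-trans (n<1+n j) 1+j<α)
  ... | x′ , x′≡1+β+j = trans
    (adjacent (2 + j) (s≤s (s≤s z≤n)) (≤-trans 1+j<α (m≤m+n α β)) x′ x
      (blockSwap-functional (shape x′) (low (<-trans (n<1+n j) 1+j<α)) x′≡1+β+j)
      (blockSwap-functional (shape x) (low 1+j<α) x≡2+β+j))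
    (cong suc (low-value j (<-trans (n<1+n j) 1+j<α) x′ x′≡1+β+j))

  -- The low block takes the values B…s (horizontal steps), the high block s+1…s+β.
  s : ℕ
  s = a + B

  high-value : ∀ j → j < β → ∀ x → toℕ x ≡ suc j → value x ≡ s + suc j
  high-value zero 0<β x x≡1 with low-index a (n<1+n a)
  ... | x′ , x′≡1+β+a = trans
    (adjacent (2 + a) (s≤s (s≤s z≤n)) (s≤s (subst (suc a ≤_) (sym (+-suc a b)) (s≤s (m≤m+n a b))))
      x′ x
      (blockSwap-functional (shape x′) (low (n<1+n a)) x′≡1+β+a)
      (trans (blockSwap-functional (shape x) (high 0<β) x≡1) (cong (3 +_) (+-identityʳ a))))
    (trans (cong suc (low-value a (n<1+n a) x′ x′≡1+β+a)) (+-comm 1 s))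
  high-value (suc j) 1+j<β x x≡2+j with high-index j (<-trans (n<1+n j) 1+j<β)
  ... | x′ , x′≡1+j = trans
    (adjacent (2 + α + j) (s≤s (s≤s z≤n)) (subst (_≤ α + β) α+2+j≡2+α+j (+-monoʳ-≤ α 1+j<β))
      x′ x
      (blockSwap-functional (shape x′) (high (<-trans (n<1+n j) 1+j<β)) x′≡1+j)
      (trans (blockSwap-functional (shape x) (high 1+j<β) x≡2+j) (cong (2 +_) (+-suc α j))))
    (trans (cong suc (high-value j (<-trans (n<1+n j) 1+j<β) x′ x′≡1+j)) (sym (+-suc s (suc j))))
    where
    α+2+j≡2+α+j : α + suc (suc j) ≡ 2 + α + j
    α+2+j≡2+α+j = trans (+-suc α (suc j)) (cong suc (+-suc α j))

  first-low last-high first last : Fin k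
  first-low = proj₁ (low-index 0 (s≤s z≤n))
  last-high = proj₁ (high-index b (n<1+n b))
  first = proj₁ (index 0 z≤n)
  last = proj₁ (index (suc (α + β)) ≤-refl)

  pat-first-low : pat first-low ≡ 2
  pat-first-low =
    blockSwap-functional (shape first-low) (low (s≤s z≤n)) (proj₂ (low-index 0 (s≤s z≤n)))

  pat-last-high : pat last-high ≡ suc (α + β)
  pat-last-high =
    trans (blockSwap-functional (shape last-high) (high (n<1+n b)) (proj₂ (high-index b (n<1+n b))))
          (cong suc (sym (+-suc α b)))

  pat-first : pat first ≡ 1
  pat-first = blockSwap-functional (shape first) start (proj₂ (index 0 z≤n))

  pat-last : pat last ≡ suc (suc (α + β))
  pat-last = blockSwap-functional (shape last) end (proj₂ (index (suc (α + β)) ≤-refl))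

  last-high-value : value last-high ≡ s + β
  last-high-value = high-value b (n<1+n b) last-high (proj₂ (high-index b (n<1+n b)))

  runs : (∀ z → toℕ z ≤ toℕ last-high → Left (ι z)) ×
         (∀ z → toℕ first-low ≤ toℕ z → Right (ι z))
  runs = inversion-splits O last-high first-low
    (subst₂ _<_ (sym (proj₂ (high-index b (n<1+n b)))) (sym (proj₂ (low-index 0 (s≤s z≤n))))
      (s≤s (m≤m+n β 0)))
    (subst₂ _<_ (sym pat-first-low) (sym (trans pat-last-high (cong suc (+-suc α b))))
      (s≤s (s≤s (s≤s z≤n))))

  left-run : ∀ x → toℕ x ≤ β → Left (ι x)
  left-run x x≤β = proj₁ runs x (subst (toℕ x ≤_) (sym (proj₂ (high-index b (n<1+n b)))) x≤β)

  right-run : ∀ x → β < toℕ x → Right (ι x)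
  right-run x β<x = proj₂ runs x
    (subst (_≤ toℕ x) (trans (cong suc (sym (+-identityʳ β))) (sym (proj₂ (low-index 0 (s≤s z≤n)))))
      β<x)

  B≤s : B ≤ s
  B≤s = m≤n+m B a

  horizontal-low : ∀ t → B ≤ t → t ≤ s → Horiz ρ d t
  horizontal-low t B≤t t≤s =
    subst (Horiz ρ d) (trans (low-value (t ∸ B) j<α x x≡1+β+j) (m∸n+n≡m B≤t))
      (right⇒horiz (ι x) (right-run x (subst (β <_) (sym x≡1+β+j) (s≤s (m≤m+n β _)))))
    where
    j<α : t ∸ B < α
    j<α = s≤s (subst (t ∸ B ≤_) (m+n∸n≡m a B) (∸-monoˡ-≤ B t≤s))
    x : Fin k
    x = proj₁ (low-index (t ∸ B) j<α)
    x≡1+β+j : toℕ x ≡ suc (β + (t ∸ B))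
    x≡1+β+j = proj₂ (low-index (t ∸ B) j<α)

  vertical-high : ∀ t → s < t → t ≤ s + β → Vert ρ d t
  vertical-high t s<t t≤s+β =
    subst (Vert ρ d) (trans (high-value (t ∸ suc s) j<β x x≡1+j) s+1+j≡t)
      (left⇒vert (ι x) (left-run x (subst (_≤ β) (sym x≡1+j) j<β)))
    where
    s+1+j≡t : s + suc (t ∸ suc s) ≡ t
    s+1+j≡t = trans (+-suc s (t ∸ suc s)) (m+[n∸m]≡n s<t)
    j<β : t ∸ suc s < β
    j<β = +-cancelˡ-≤ s _ _ (subst (_≤ s + β) (sym s+1+j≡t) t≤s+β)
    x : Fin k
    x = proj₁ (high-index (t ∸ suc s) j<β)
    x≡1+j : toℕ x ≡ suc (t ∸ suc s)
    x≡1+j = proj₂ (high-index (t ∸ suc s) j<β)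

  first-below : value first < B
  first-below = value-< first first-low (subst₂ _<_ (sym pat-first) (sym pat-first-low) (s≤s (s≤s z≤n)))

  first-vert : Vert ρ d (value first)
  first-vert = left⇒vert (ι first) (left-run first (subst (_≤ β) (sym (proj₂ (index 0 z≤n))) z≤n))

  last-above : s + β < value last
  last-above = subst (_< value last) last-high-value
    (value-< last-high last (subst₂ _<_ (sym pat-last-high) (sym pat-last) ≤-refl))

  last-horiz : Horiz ρ d (value last)
  last-horiz = right⇒horiz (ι last)
    (right-run last (subst (β <_) (sym (proj₂ (index (suc (α + β)) ≤-refl))) (s≤s (m≤n+m β α))))

  first-adjacent : Y 1 → suc (value first) ≡ B
  first-adjacent Y1 =
    sym (value-adjacent 1 Y1 (subst (1 ≤_) (sym size) (s≤s z≤n)) first first-low pat-first pat-first-low)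

  last-adjacent : Y (suc (α + β)) → value last ≡ suc (s + β)
  last-adjacent Y-penultimate = trans
    (value-adjacent _ Y-penultimate (subst (suc (α + β) ≤_) (sym size) (n≤1+n _))
      last-high last pat-last-high pat-last)
    (cong suc last-high-value)

  s∸first≡α : suc (value first) ≡ B → s ∸ value first ≡ α
  s∸first≡α 1+first≡B = trans (cong (λ B′ → a + B′ ∸ value first) (sym 1+first≡B))
    (trans (cong (_∸ value first) (+-suc a (value first))) (m+n∸n≡m α (value first)))

  corner : Σ ℕ λ s → Σ ℕ λ u → Σ ℕ λ l → OuterCorner ρ d s u l × α ≤ l × β ≤ u ×
    (Y (suc (α + β)) → u ≡ β) × (Y 1 → l ≡ α)
  corner =
    let u , β≤u , vertical , top , u-exact = vertical-run-extends vertical-high last-above last-horiz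
        l , s<l+B , l<s , horizontal , bottom , l-exact =
          horizontal-run-extends horizontal-low B≤s first-below first-vert
        1≤u = ≤-trans (s≤s z≤n) β≤u
        α≤l = +-cancelʳ-< B a l s<l+B
    in
    s , u , l ,
    (horizontal-low s B≤s ≤-refl ,
     vertical (suc s) (n<1+n s) (subst (_≤ s + u) (+-comm s 1) (+-monoʳ-≤ s 1≤u)) , 1≤u ,
     vertical , top , ≤-trans (s≤s z≤n) α≤l , l<s , horizontal , bottom) ,
    α≤l , β≤u , u-exact ∘ last-adjacent ,
    λ Y1 → trans (l-exact (first-adjacent Y1)) (s∸first≡α (first-adjacent Y1))

module _ {m : ℕ} (ρ : Permutation′ m) {d : ℕ} (descent : DescentAt ρ d)
  (only-descent : ∀ d′ → DescentAt ρ d′ → d′ ≡ d) where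

  tooWide⇒F : TooWide ρ → Σ ℕ λ n → (2 ≤ n) × Contains ρ (F n)
  tooWide⇒F (d′ , descent′ , s , u , l , corner@(_ , _ , 1≤u , _) , u<l) with only-descent d′ descent′
  ... | refl = suc u , s≤s 1≤u ,
    corner⇒blockSwap ρ only-descent corner (s≤s z≤n) u<l ≤-refl (f (suc u)) (f-blockSwap u)
      (cong suc (2*[1+n]≡2+[n+n] u)) (Bivincular.Y (F (suc u)))
      (λ { y (2≤y , y≤2+2u) →
             ≤-trans (s≤s z≤n) 2≤y , subst (y ≤_) (2*[1+n]≡2+[n+n] u) y≤2+2u })
      (λ { (s≤s () , _) }) (λ _ → refl)

  F⇒tooWide : Σ ℕ (λ n → (2 ≤ n) × Contains ρ (F n)) → TooWide ρ
  F⇒tooWide (suc (suc u) , s≤s (s≤s z≤n) , O) =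
    let s , u′ , l , corner , 2+u≤l , _ , u′-exact , _ = BlockSwapToCorner.corner ρ only-descent O
          (f-blockSwap (suc u)) (cong suc (2*[1+n]≡2+[n+n] (suc u)))
          (λ y 2≤y y≤3+2u → 2≤y , ≤-trans y≤3+2u
            (subst (suc (suc u) + suc u ≤_) (sym (2*[1+n]≡2+[n+n] (suc u))) (n≤1+n (suc (suc u) + suc u))))
    in d , descent , s , u′ , l , corner ,
       subst (_< l) (sym (u′-exact (s≤s (s≤s z≤n) , ≤-reflexive (sym (2*[1+n]≡2+[n+n] (suc u)))))) 2+u≤l

  tooDeep⇒G : TooDeep ρ → Σ ℕ λ n → (2 ≤ n) × Contains ρ (G n)
  tooDeep⇒G (d′ , descent′ , s , u , l , corner@(_ , _ , _ , _ , _ , 1≤l , _) , l<u)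
    with only-descent d′ descent′
  ... | refl = suc l , s≤s 1≤l ,
    corner⇒blockSwap ρ only-descent corner 1≤l ≤-refl l<u (g (suc l)) (g-blockSwap l)
      (1+2*[1+n]≡2+n+[1+n] l) (Bivincular.Y (G (suc l)))
      (λ { y (1≤y , y≤1+2l) →
             1≤y , ≤-trans (subst (y ≤_) (2*[1+n]∸1≡n+[1+n] l) y≤1+2l) (n≤1+n _) })
      (λ _ → refl)
      (λ { (_ , 2+2l≤1+2l) →
             contradiction (subst (suc (l + suc l) ≤_) (2*[1+n]∸1≡n+[1+n] l) 2+2l≤1+2l) 1+n≰n })

  G⇒tooDeep : Σ ℕ (λ n → (2 ≤ n) × Contains ρ (G n)) → TooDeep ρ
  G⇒tooDeep (suc (suc q) , s≤s (s≤s z≤n) , O) =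
    let s , u , l , corner , _ , 2+q≤u , _ , l-exact = BlockSwapToCorner.corner ρ only-descent O
          (g-blockSwap (suc q)) (1+2*[1+n]≡2+n+[1+n] (suc q))
          (λ y 2≤y y≤3+2q →
            ≤-trans (s≤s z≤n) 2≤y , subst (y ≤_) (sym (2*[1+n]∸1≡n+[1+n] (suc q))) y≤3+2q)
    in d , descent , s , u , l , corner ,
       subst (_< u) (sym (l-exact (s≤s z≤n , subst (1 ≤_) (sym (2*[1+n]∸1≡n+[1+n] (suc q))) (s≤s z≤n))))
         2+q≤u

lemma2 : (m : ℕ) (ρ : Permutation′ m) → Grassmannian ρ →
    (TooWide ρ ⇔ Σ ℕ (λ n → (2 ≤ n) × Contains ρ (F n)))
    × (TooDeep ρ ⇔ Σ ℕ (λ n → (2 ≤ n) × Contains ρ (G n)))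
lemma2 m ρ (d , descent , only-descent) =
  mk⇔ (tooWide⇒F ρ descent only-descent) (F⇒tooWide ρ descent only-descent) ,
  mk⇔ (tooDeep⇒G ρ descent only-descent) (G⇒tooDeep ρ descent only-descent)
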